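{- Let $(\mathcal M_{\mathcal I},\models_\ll)$ be an indefinitely large model. Then every definable relation is indefinitely large: for every $n$-ary formula $\Phi$, the index set $\{C\in\mathcal I^n: C\vdash\Phi\}$ of the family $[\![\Phi]\!]$ belongs to $\mathfrak D_n$.
   Context: $\mathcal I$ is a non-empty set with a directed preorder $\le$; $\uparrow i=\{i'\ge i\}$. Contexts: $C=(i_0,\dots,i_{n-1})\in\mathcal I^n$, $()$ empty, $Ci$ extension. $\mathfrak D_n\subseteq\mathcal P(\mathcal I^n)$: $\mathcal H\in\mathfrak D_0$ iff $\mathcal H=\{()\}$; $\mathcal H\in\mathfrak D_1$ iff $\uparrow i\subseteq\mathcal H$ for some $i$; for $\mathcal H\subseteq\mathcal I^{n+1}$, $\mathcal H\in\mathfrak D_{n+1}$ iff $\{C\in\mathcal I^n:\{i:Ci\in\mathcal H\}\in\mathfrak D_1\}\in\mathfrak D_n$. A system $\mathcal M_{\mathcal I}=(\mathcal M_i)_{i\in\mathcal I}$: finite sets with $\mathcal M_i\subseteq\mathcal M_{i'}$ for $i\le i'$, at least one non-empty; $\mathcal M_C=\mathcal M_{i_0}\times\dots\times\mathcal M_{i_{n-1}}$. An $n$-ary relation on it is a family $(R_C)_{C\in\mathcal H}$, $\emptyset\neq\mathcal H\subseteq\mathcal I^n$, $R_C\subseteq\mathcal M_C$, with $R_C(\vec a)\iff R_{C'}(\vec a)$ for $\vec a\in\mathcal M_C\cap\mathcal M_{C'}$. $\Sigma$: first-order signature with relation symbols only; $\Sigma^{\mathcal I}$: set of assignments $R:C$,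 $C\in\mathcal I^{\mathrm{arity}(R)}$, at least one per symbol; indefinitely large iff $\{C:R:C\in\Sigma^{\mathcal I}\}\in\mathfrak D_n$ for each $n$-ary $R$. A $\Sigma^{\mathcal I}$-structure: a system together with, for each symbol $R$, a relation $R_{\mathcal H}$ on it with $\mathcal H\supseteq\{C:R:C\in\Sigma^{\mathcal I}\}$; $R:C$ is interpreted by $R_C$. A $\ll$-relation: $\ll=(\ll_n)_n$, $\ll_n\subseteq\mathcal I^n$, with $Ci\in\ll_{n+1}\Rightarrow C\in\ll_n$; elements are $\ll$-contexts; $C\ll i$ means $Ci\in\ll_{n+1}$; indefinitely large iff $\ll_n\in\mathfrak D_n$ for all $n$. Formulas: first-order over $\Sigma$, variables $x_0,x_1,\dots$, $\bot,\to,\land,\lor,\forall,\exists$, no function symbols; $\Phi(x_0,\dots,x_{n-1})$ is $n$-ary and quantifiers in an $n$-ary formula bind $x_n$. State declarations $C\vdash\Phi$ ($C$ a $\ll$-context of length $n$): $C\vdash\bot$ always; $C\vdash Rx_{k_0}\dots x_{k_{m-1}}$ iff some $j_0,\dots,j_{m-1}$ with $j_l\ge i_{k_l}$ have $R:(j_0,\dots,j_{m-1})\in\Sigma^{\mathcal I}$; $C\vdash\Phi\circ\Psi$ iff $C\vdash\Phi$ and $C\vdash\Psi$; $C\vdash\forall x\Psi$ iff $C\vdash\exists x\Psi$ iff $Ci\vdash\Psi$ for some $i$ with $C\ll i$. Interpretation, for $C\vdash\Phi$ and $\vec a=(a_0,\dots,a_{n-1})\in\mathcal M_C$: $\mathcal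 M_{\mathcal I}\models_\ll Rx_{k_0}\dots x_{k_{m-1}}[\vec a:C]$ iff $R_{(j_0,\dots,j_{m-1})}(a_{k_0},\dots,a_{k_{m-1}})$ for some $(j_0,\dots,j_{m-1})$ as in the declaration; $\bot$ never holds; connectives classically; $\models_\ll\forall x\Phi[\vec a:C]$ iff for some $i$ with $C\ll i$ and $Ci\vdash\Phi$, $\models_\ll\Phi[\vec ab:Ci]$ for all $b\in\mathcal M_i$; $\models_\ll\exists x\Phi[\vec a:C]$ iff for all $i$ with $C\ll i$ and $Ci\vdash\Phi$, $\models_\ll\Phi[\vec ab:Ci]$ for some $b\in\mathcal M_i$. $[\![\Phi]\!]$ is the family $([\![\Phi]\!]_C)_{C\vdash\Phi}$ with $[\![\Phi]\!]_C=\{\vec a\in\mathcal M_C:\models_\ll\Phi[\vec a:C]\}$. The model $(\mathcal M_{\mathcal I},\models_\ll)$ is indefinitely large iff $\Sigma^{\mathcal I}$ and $\ll$ are indefinitely large. -}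

module Defs where

open import Data.Nat using (ℕ; zero; suc)
open import Data.Fin using (Fin)
open import Data.Vec using (Vec; []; _∷_; _∷ʳ_; lookup; map)
open import Data.List using (List)
open import Data.List.Membership.Propositional using (_∈_)
open import Data.Product using (Σ; ∃; ∃-syntax; _×_; _,_)
open import Data.Sum using (_⊎_)
open import Data.Empty using (⊥)
open import Data.Unit using (⊤)
open import Function.Bundles using (_⇔_)

record Frame : Set₁ where
  field
    I       : Set
    _≤_     : I → I → Set
    ≤-refl  : ∀ {i} → i ≤ i
    ≤-trans : ∀ {i j k} → i ≤ j → j ≤ k → i ≤ k
    directed  : ∀ i j → ∃[ k ] (i ≤ k × j ≤ k)
    inhabited : I

module _ (F : Frame) where
  open Frame F

  -- subsets of 𝓘ⁿ are predicates on contexts (vectors of length n);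
  -- context extension C i is snoc  C ∷ʳ i.

  𝔇₁ : (I → Set) → Set
  𝔇₁ H = ∃[ i ] (∀ i′ → i ≤ i′ → H i′)

  𝔇 : (n : ℕ) → (Vec I n → Set) → Set
  𝔇 zero    H = H []      -- 𝓗 = {()}  iff  () ∈ 𝓗 (as 𝓘⁰ = {()})
  𝔇 (suc n) H = 𝔇 n (λ C → 𝔇₁ (λ i → H (C ∷ʳ i)))

record Signature : Set₁ where
  field
    Sym   : Set
    arity : Sym → ℕ

module _ (S : Signature) where
  open Signature S

  -- n-ary formulas: free variables among x₀ … x_{n-1};
  -- quantifiers in an n-ary formula bind xₙ.
  data Formula : ℕ → Set where
    ⊥ᶠ       : ∀ {n} → Formula n
    rel      : ∀ {n} (R : Sym) → Vec (Fin n) (arity R) → Formula n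
    _⇒ᶠ_ _∧ᶠ_ _∨ᶠ_ : ∀ {n} → Formula n → Formula n → Formula n
    ∀ᶠ ∃ᶠ    : ∀ {n} → Formula (suc n) → Formula n

module _ (F : Frame) (S : Signature) where
  open Frame F
  open Signature S

  record Model : Set₁ where
    field
      SigI          : (R : Sym) → Vec I (arity R) → Set
      SigI-nonempty : ∀ R → ∃[ C ] SigI R C
      ≪             : (n : ℕ) → Vec I n → Set
      ≪-closed      : ∀ {n} (C : Vec I n) i → ≪ (suc n) (C ∷ʳ i) → ≪ n C
      -- the system 𝓜_𝓘 : elements live in a carrier U, 𝓜ᵢ ⊆ U
      U             : Set
      M             : I → U → Set
      M-finite      : ∀ i → ∃[ xs ] (∀ a → (M i a ⇔ (a ∈ xs)))
      M-mono        : ∀ {i i′} → i ≤ i′ → ∀ {a} → M i a → M i′ a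
      M-nonempty    : ∃[ i ] ∃[ a ] M i a
      H             : (R : Sym) → Vec I (arity R) → Set
      H-nonempty    : ∀ R → ∃[ C ] H R C
      H-⊇           : ∀ R C → SigI R C → H R C
      Rel           : (R : Sym) → Vec I (arity R) → Vec U (arity R) → Set
      Rel-⊆         : ∀ R C a → H R C → Rel R C a → ∀ k → M (lookup C k) (lookup a k)
      Rel-coh       : ∀ R C C′ a → H R C → H R C′
                      → (∀ k → M (lookup C k) (lookup a k))
                      → (∀ k → M (lookup C′ k) (lookup a k))
                      → Rel R C a → Rel R C′ a

  module _ (𝓜 : Model) where
    open Model 𝓜

    InM : ∀ {n} → Vec I n → Vec U n → Set
    InM C a = ∀ k → M (lookup C k) (lookup a k)

    -- State declarations  C ⊢ Φ  (the ≪-context condition is added separately)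
    Decl : ∀ {n} → Formula S n → Vec I n → Set
    Decl ⊥ᶠ C = ⊤
    Decl (rel R ks) C =
      ∃[ js ] ((∀ l → lookup C (lookup ks l) ≤ lookup js l) × SigI R js)
    Decl (Φ ⇒ᶠ Ψ) C = Decl Φ C × Decl Ψ C
    Decl (Φ ∧ᶠ Ψ) C = Decl Φ C × Decl Ψ C
    Decl (Φ ∨ᶠ Ψ) C = Decl Φ C × Decl Ψ C
    Decl {n} (∀ᶠ Ψ) C = ∃[ i ] (≪ (suc n) (C ∷ʳ i) × Decl Ψ (C ∷ʳ i))
    Decl {n} (∃ᶠ Ψ) C = ∃[ i ] (≪ (suc n) (C ∷ʳ i) × Decl Ψ (C ∷ʳ i))

    _⊢_ : ∀ {n} → Vec I n → Formula S n → Set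
    _⊢_ {n} C Φ = ≪ n C × Decl Φ C

    Sat : ∀ {n} → Formula S n → Vec I n → Vec U n → Set
    Sat ⊥ᶠ C a = ⊥
    Sat (rel R ks) C a =
      ∃[ js ] ((∀ l → lookup C (lookup ks l) ≤ lookup js l) × SigI R js
               × Rel R js (map (lookup a) ks))
    Sat (Φ ⇒ᶠ Ψ) C a = Sat Φ C a → Sat Ψ C a
    Sat (Φ ∧ᶠ Ψ) C a = Sat Φ C a × Sat Ψ C a
    Sat (Φ ∨ᶠ Ψ) C a = Sat Φ C a ⊎ Sat Ψ C a
    Sat {n} (∀ᶠ Φ) C a =
      ∃[ i ] (≪ (suc n) (C ∷ʳ i) × Decl Φ (C ∷ʳ i)
              × (∀ b → M i b → Sat Φ (C ∷ʳ i) (a ∷ʳ b)))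
    Sat {n} (∃ᶠ Φ) C a =
      ∀ i → ≪ (suc n) (C ∷ʳ i) → Decl Φ (C ∷ʳ i)
          → ∃[ b ] (M i b × Sat Φ (C ∷ʳ i) (a ∷ʳ b))

    record Family (n : ℕ) : Set₁ where
      field
        index : Vec I n → Set
        member : Vec I n → Vec U n → Set

    ⟦_⟧ : ∀ {n} → Formula S n → Family n
    ⟦ Φ ⟧ = record
      { index  = λ C → C ⊢ Φ
      ; member = λ C a → InM C a × Sat Φ C a }

    IndefinitelyLarge : Set
    IndefinitelyLarge =
      (∀ R → 𝔇 F (arity R) (SigI R)) × (∀ n → 𝔇 F n (≪ n))

module Submission where

open import Defs
open import Data.Nat using (ℕ; zero; suc)
open import Data.Fin using (Fin)
open import Data.Vec using (Vec; []; _∷_; _∷ʳ_; lookup; map; initLast)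
open import Data.Vec.Properties using (lookup-map)
open import Data.Vec.Relation.Binary.Pointwise.Inductive as Pointwise
  using (Pointwise; []; _∷_)
open import Data.Product using (∃-syntax; _×_; _,_)
open import Data.Unit using (tt)
open import Relation.Binary.PropositionalEquality using (refl; subst)

-- The sets of 𝔇ₙ form a filter on 𝓘ⁿ, and every member of it contains contexts
-- pointwise above any given one. Relational declarations therefore hold everywhere,
-- and by induction on Φ the declared contexts of each formula form a member of the
-- filter: connectives intersect two members, and for a quantifier a member of 𝔇ₙ₊₁
-- yields, above a member of 𝔇ₙ, the extension C i that the declaration asks for.

Pointwise-∷ʳ : ∀ {A : Set} {R : A → A → Set} {n} {xs ys : Vec A n} {x y}
  → Pointwise R xs ys → R x y → Pointwise R (xs ∷ʳ x) (ys ∷ʳ y)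
Pointwise-∷ʳ []       r = r ∷ []
Pointwise-∷ʳ (p ∷ ps) r = p ∷ Pointwise-∷ʳ ps r

module _ (F : Frame) where
  open Frame F

  𝔇₁⇒∃ : {H : I → Set} → 𝔇₁ F H → ∃[ i ] H i
  𝔇₁⇒∃ (i , above) = i , above i ≤-refl

  𝔇₁-mono : {H H′ : I → Set} → (∀ i → H i → H′ i) → 𝔇₁ F H → 𝔇₁ F H′
  𝔇₁-mono H⊆H′ (i , above) = i , λ i′ i≤i′ → H⊆H′ i′ (above i′ i≤i′)

  𝔇-mono : ∀ n {H H′ : Vec I n → Set} → (∀ C → H C → H′ C) → 𝔇 F n H → 𝔇 F n H′
  𝔇-mono zero    H⊆H′ = H⊆H′ []
  𝔇-mono (suc n) H⊆H′ = 𝔇-mono n (λ C → 𝔇₁-mono (λ i → H⊆H′ (C ∷ʳ i)))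

  𝔇₁-∩ : {H H′ : I → Set} → 𝔇₁ F H → 𝔇₁ F H′ → 𝔇₁ F (λ i → H i × H′ i)
  𝔇₁-∩ (i , aboveᵢ) (j , aboveⱼ) with directed i j
  ... | k , i≤k , j≤k =
    k , λ k′ k≤k′ → aboveᵢ k′ (≤-trans i≤k k≤k′) , aboveⱼ k′ (≤-trans j≤k k≤k′)

  𝔇-∩ : ∀ n {H H′ : Vec I n → Set} → 𝔇 F n H → 𝔇 F n H′ → 𝔇 F n (λ C → H C × H′ C)
  𝔇-∩ zero    h h′ = h , h′
  𝔇-∩ (suc n) h h′ = 𝔇-mono n (λ C (d , d′) → 𝔇₁-∩ d d′) (𝔇-∩ n h h′)

  𝔇-cofinal : ∀ n {H : Vec I n → Set} → 𝔇 F n H → (C : Vec I n)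
    → ∃[ C′ ] (Pointwise _≤_ C C′ × H C′)
  𝔇-cofinal zero    h [] = [] , [] , h
  𝔇-cofinal (suc n) h C with initLast C
  ... | D , i , refl with 𝔇-cofinal n h D
  ... | D′ , D≤D′ , (j , above) with directed j i
  ... | k , j≤k , i≤k = D′ ∷ʳ k , Pointwise-∷ʳ D≤D′ i≤k , above k j≤k

module _ (F : Frame) (S : Signature) (𝓜 : Model F S) where
  open Frame F
  open Signature S using (arity)
  open Model 𝓜

  private
    _⊢ᴹ_ : ∀ {n} → Vec I n → Formula S n → Set
    _⊢ᴹ_ = _⊢_ F S 𝓜

  rel-declared : (∀ R → 𝔇 F (arity R) (SigI R))
    → ∀ {n} R (ks : Vec (Fin n) (arity R)) (C : Vec I n) → Decl F S 𝓜 (rel R ks) C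
  rel-declared sigI-large R ks C with 𝔇-cofinal F _ (sigI-large R) (map (lookup C) ks)
  ... | js , Cks≤js , R∶js = js , below , R∶js
    where
    below : ∀ l → lookup C (lookup ks l) ≤ lookup js l
    below l = subst (_≤ lookup js l) (lookup-map l (lookup C) ks) (Pointwise.lookup Cks≤js l)

  ⊢-binary : ∀ n {Φ Ψ : Formula S n}
    → 𝔇 F n (_⊢ᴹ Φ) → 𝔇 F n (_⊢ᴹ Ψ)
    → 𝔇 F n (λ C → ≪ n C × Decl F S 𝓜 Φ C × Decl F S 𝓜 Ψ C)
  ⊢-binary n Φ-large Ψ-large =
    𝔇-mono F n (λ C ((≪C , declΦ) , (_ , declΨ)) → ≪C , declΦ , declΨ)
      (𝔇-∩ F n Φ-large Ψ-large)

  ⊢-quantifier : ∀ n {Ψ : Formula S (suc n)} → 𝔇 F n (≪ n) → 𝔇 F (suc n) (_⊢ᴹ Ψ)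
    → 𝔇 F n (λ C → ≪ n C × ∃[ i ] (≪ (suc n) (C ∷ʳ i) × Decl F S 𝓜 Ψ (C ∷ʳ i)))
  ⊢-quantifier n ≪-large Ψ-large =
    𝔇-mono F n (λ C (≪C , Ψ-above) → ≪C , 𝔇₁⇒∃ F Ψ-above) (𝔇-∩ F n ≪-large Ψ-large)

lemma4p4 : (F : Frame) (S : Signature) (𝓜 : Model F S)
    → IndefinitelyLarge F S 𝓜
    → (n : ℕ) (Φ : Formula S n)
    → 𝔇 F n (Family.index (⟦_⟧ F S 𝓜 Φ))
lemma4p4 F S 𝓜 (sigI-large , ≪-large) = declared
  where
  declared : (n : ℕ) (Φ : Formula S n) → 𝔇 F n (λ C → _⊢_ F S 𝓜 C Φ)
  declared n ⊥ᶠ         = 𝔇-mono F n (λ _ ≪C → ≪C , tt) (≪-large n)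
  declared n (rel R ks) =
    𝔇-mono F n (λ C ≪C → ≪C , rel-declared F S 𝓜 sigI-large R ks C) (≪-large n)
  declared n (Φ ⇒ᶠ Ψ)   = ⊢-binary F S 𝓜 n (declared n Φ) (declared n Ψ)
  declared n (Φ ∧ᶠ Ψ)   = ⊢-binary F S 𝓜 n (declared n Φ) (declared n Ψ)
  declared n (Φ ∨ᶠ Ψ)   = ⊢-binary F S 𝓜 n (declared n Φ) (declared n Ψ)
  declared n (∀ᶠ Ψ)     = ⊢-quantifier F S 𝓜 n (≪-large n) (declared (suc n) Ψ)
  declared n (∃ᶠ Ψ)     = ⊢-quantifier F S 𝓜 n (≪-large n) (declared (suc n) Ψ)
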